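{- Let $G$ be a graph on $n\ge 5$ vertices and $m$ edges with $\chi_s(G)=n-1$. If $m>\frac{(n-1)(n-2)}{2}$, then $G$ is not $(n-1)$-critical.
   Context: Standing assumption of the paper: all graphs are finite, undirected, simple and connected. A star coloring of $G$ is a proper vertex-coloring such that no path on four vertices (as a subgraph) is colored with only two colors; $\chi_s(G)$ is the minimum number of colors in a star coloring of $G$. $G$ is $k$-critical if $\chi_s(G)=k$ and $\chi_s(G-e)<\chi_s(G)$ for every edge $e$, where $G-e$ denotes deletion of the edge $e$. -}

module Defs where

open import Data.Nat using (ℕ; zero; suc; _+_; _*_; _<_; _<ᵇ_)
open import Data.Fin using (Fin; toℕ; _≟_)
open import Data.Bool using (Bool; true; false; _∧_; _∨_; not; if_then_else_)
open import Data.List using (List; allFin; map)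
open import Data.Nat.ListAction using (sum)
open import Data.Product using (Σ; ∃; ∃-syntax; _×_; _,_)
open import Relation.Binary.PropositionalEquality using (_≡_; _≢_)
open import Relation.Nullary using (¬_)
open import Relation.Nullary.Decidable using (⌊_⌋)

record Graph (n : ℕ) : Set where
  field
    adj   : Fin n → Fin n → Bool
    sym   : ∀ u v → adj u v ≡ adj v u
    irrefl : ∀ v → adj v v ≡ false
open Graph public

Adj : ∀ {n} → Graph n → Fin n → Fin n → Set
Adj G u v = adj G u v ≡ true

data Walk {n : ℕ} (G : Graph n) : Fin n → Fin n → Set where
  here : ∀ {u} → Walk G u u
  step : ∀ {u v w} → Adj G u v → Walk G v w → Walk G u w

Connected : ∀ {n} → Graph n → Set
Connected G = ∀ u v → Walk G u v

edgeCount : ∀ {n} → Graph n → ℕ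
edgeCount {n} G =
  sum (map (λ i → sum (map (λ j → if (toℕ i <ᵇ toℕ j) ∧ adj G i j then 1 else 0)
                           (allFin n)))
           (allFin n))

Proper : ∀ {n k} → Graph n → (Fin n → Fin k) → Set
Proper G c = ∀ u v → Adj G u v → c u ≢ c v

P4 : ∀ {n} → Graph n → Fin n → Fin n → Fin n → Fin n → Set
P4 G a b c d =
  a ≢ b × a ≢ c × a ≢ d × b ≢ c × b ≢ d × c ≢ d ×
  Adj G a b × Adj G b c × Adj G c d

-- In a proper colouring, a path a-b-c-d uses only two colours
-- iff col a = col c and col b = col d.
TwoColouredP4 : ∀ {n k} → Graph n → (Fin n → Fin k) → Set
TwoColouredP4 {n} G col =
  Σ (Fin n) λ a → Σ (Fin n) λ b → Σ (Fin n) λ c → Σ (Fin n) λ d →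
    P4 G a b c d × col a ≡ col c × col b ≡ col d

StarColouring : ∀ {n} → Graph n → (k : ℕ) → (Fin n → Fin k) → Set
StarColouring G k col = Proper G col × ¬ TwoColouredP4 G col

StarColourable : ∀ {n} → Graph n → ℕ → Set
StarColourable {n} G k = Σ (Fin n → Fin k) (StarColouring G k)

StarChromatic : ∀ {n} → Graph n → ℕ → Set
StarChromatic G k = StarColourable G k × (∀ j → j < k → ¬ StarColourable G j)

deleteEdge : ∀ {n} → (G : Graph n) → Fin n → Fin n → Graph n
deleteEdge {n} G u v = record
  { adj = adj'
  ; sym = sym'
  ; irrefl = irr
  }
  where
  isE : Fin n → Fin n → Bool
  isE x y = (⌊ x ≟ u ⌋ ∧ ⌊ y ≟ v ⌋) ∨ (⌊ x ≟ v ⌋ ∧ ⌊ y ≟ u ⌋)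
  adj' : Fin n → Fin n → Bool
  adj' x y = adj G x y ∧ not (isE x y)
  open import Data.Bool.Properties using (∨-comm)
  open import Relation.Binary.PropositionalEquality using (cong₂)
  sym' : ∀ x y → adj' x y ≡ adj' y x
  sym' x y = cong₂ (λ p q → p ∧ not q) (Graph.sym G x y)
                   (Relation.Binary.PropositionalEquality.trans
                     (∨-comm (⌊ x ≟ u ⌋ ∧ ⌊ y ≟ v ⌋) (⌊ x ≟ v ⌋ ∧ ⌊ y ≟ u ⌋)) helper)
    where
    open import Data.Bool.Properties using (∧-comm)
    helper : ((⌊ x ≟ v ⌋ ∧ ⌊ y ≟ u ⌋) ∨ (⌊ x ≟ u ⌋ ∧ ⌊ y ≟ v ⌋)) ≡ isE y x
    helper = cong₂ _∨_ (∧-comm (⌊ x ≟ v ⌋) (⌊ y ≟ u ⌋)) (∧-comm (⌊ x ≟ u ⌋) (⌊ y ≟ v ⌋))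
  irr : ∀ x → adj' x x ≡ false
  irr x rewrite Graph.irrefl G x = Relation.Binary.PropositionalEquality.refl

Critical : ∀ {n} → Graph n → ℕ → Set
Critical G k =
  StarChromatic G k ×
  (∀ u v → Adj G u v → ∃[ j ] (j < k × StarChromatic (deleteEdge G u v) j))

module Submission where

-- If the complement of G contains a triangle or a 4-cycle, a rainbow colouring that gives the
-- triangle one colour, or each diagonal pair of the 4-cycle one colour, is a star colouring
-- with n − 2 colours; so when χ_s(G) = n − 1 the complement contains neither. The edge bound
-- leaves at most n − 2 non-edges, so the complement is disconnected: pick u, v in different
-- components, necessarily adjacent in G. If G were critical, G − uv would have a star
-- colouring with at most n − 2 colours, and two pigeonhole steps find in its complement a
-- triangle or a 4-cycle (otherwise there is a two-coloured P4). That cycle cannot pass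
-- through uv, as the rest of it would join u to v in the complement of G, so it lies in the
-- complement of G: a contradiction.

open import Defs hiding (sym)
open import Data.Nat using (ℕ; zero; suc; _+_; _*_; _∸_; _<_; _≤_; z≤n; s≤s; _<ᵇ_)
open import Data.Nat.Properties as ℕ using (+-0-commutativeMonoid)
open import Data.Nat.Tactic.RingSolver using (solve-∀)
import Data.Nat.ListAction as ListSum
open import Algebra.Properties.CommutativeMonoid.Sum +-0-commutativeMonoid
  using (sum-syntax; ∑-distrib-+; sum-cong-≗)
open import Data.Fin as Fin using (Fin; zero; suc; toℕ; punchIn; punchOut)
import Data.Fin.Properties as Finₚ
open import Data.Bool as Bool using (Bool; true; false; _∧_; _∨_; not; if_then_else_; T)
open import Data.List using ([]; _∷_; map; allFin; tabulate)
open import Data.List.Properties using (map-tabulate)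
open import Data.List.Membership.Propositional using (_∈_; _∉_)
open import Data.List.Relation.Unary.Any using (here; there)
open import Data.Product using (∃-syntax; _×_; _,_; proj₁; proj₂)
open import Data.Sum as Sum using (_⊎_; inj₁; inj₂)
open import Data.Unit using (tt)
open import Data.Empty using (⊥; ⊥-elim)
open import Function using (_∘_; id)
open import Function.Definitions using (StrictlySurjective)
open import Relation.Nullary using (¬_; Dec; yes; no)
open import Relation.Nullary.Decidable using (⌊_⌋; toWitness)
open import Relation.Binary using (tri<; tri≈; tri>)
open import Relation.Binary.PropositionalEquality

module _ {k : ℕ} {a b : Fin (suc k)} (b≢a : b ≢ a) where

  glue : Fin (suc k) → Fin k
  glue x with b Fin.≟ x
  ... | yes _  = punchOut b≢a
  ... | no b≢x = punchOut b≢x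

  glue-identifies : glue a ≡ glue b
  glue-identifies with b Fin.≟ a | b Fin.≟ b
  ... | yes b≡a | _      = ⊥-elim (b≢a b≡a)
  ... | no _    | yes _  = Finₚ.punchOut-cong b refl
  ... | no _    | no b≢b = ⊥-elim (b≢b refl)

  glue-collision : ∀ x y → glue x ≡ glue y → x ≡ y ⊎ (x ∈ a ∷ b ∷ [] × y ∈ a ∷ b ∷ [])
  glue-collision x y gx≡gy with b Fin.≟ x | b Fin.≟ y
  ... | yes b≡x | yes b≡y = inj₁ (trans (sym b≡x) b≡y)
  ... | yes b≡x | no b≢y  =
    inj₂ (there (here (sym b≡x)) , here (sym (Finₚ.punchOut-injective b≢a b≢y gx≡gy)))
  ... | no b≢x  | yes b≡y =
    inj₂ (here (Finₚ.punchOut-injective b≢x b≢a gx≡gy) , there (here (sym b≡y)))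
  ... | no b≢x  | no b≢y  = inj₁ (Finₚ.punchOut-injective b≢x b≢y gx≡gy)

  glue-cancel : ∀ {x z} → z ∉ a ∷ b ∷ [] → glue x ≡ glue z → x ≡ z
  glue-cancel {x} {z} z∉ab gx≡gz with glue-collision x z gx≡gz
  ... | inj₁ x≡z        = x≡z
  ... | inj₂ (_ , z∈ab) = ⊥-elim (z∉ab z∈ab)

  glue-surjective : StrictlySurjective _≡_ glue
  glue-surjective l = punchIn b l , glue-punchIn
    where
    glue-punchIn : glue (punchIn b l) ≡ l
    glue-punchIn with b Fin.≟ punchIn b l
    ... | yes b≡b↑l = ⊥-elim (Finₚ.punchInᵢ≢i b l (sym b≡b↑l))
    ... | no _      = trans (Finₚ.punchOut-cong b refl) (Finₚ.punchOut-punchIn b)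

∉-pair : ∀ {n} {x a b : Fin n} → a ≢ x → b ≢ x → x ∉ a ∷ b ∷ []
∉-pair a≢x b≢x (here x≡a)         = a≢x (sym x≡a)
∉-pair a≢x b≢x (there (here x≡b)) = b≢x (sym x≡b)

record Partition (n : ℕ) : Set where
  constructor partition
  field
    classes          : ℕ
    label            : Fin n → Fin classes
    label-surjective : StrictlySurjective _≡_ label
open Partition

discrete : ∀ {n} → Partition n
discrete {n} = partition n id (λ l → l , refl)

_⊑_ : ∀ {n} → Partition n → Partition n → Set
p ⊑ q = ∀ x y → label p x ≡ label p y → label q x ≡ label q y

⊑-refl : ∀ {n} (p : Partition n) → p ⊑ p
⊑-refl _ _ _ e = e

Joins : ∀ {n} → Fin n → Fin n → Partition n → Set
Joins x y p = label p x ≡ label p y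

UpwardClosed : ∀ {n} → (Partition n → Set) → Set
UpwardClosed E = ∀ {p q} → p ⊑ q → E p → E q

Reachable : ∀ {n} → ℕ → (Partition n → Set) → Partition n → Set
Reachable cost E p = ∃[ q ] (p ⊑ q × E q × classes p ≤ cost + classes q)

merge : ∀ {n} (p : Partition n) (x y : Fin n) → Reachable 1 (Joins x y) p
merge (partition zero label _) x y with label x
... | ()
merge p@(partition (suc c) label surjective) x y with label x Fin.≟ label y
... | yes same  = p , ⊑-refl p , same , ℕ.n≤1+n _
... | no differ =
  partition c (glue y≢x ∘ label) glued-surjective ,
  (λ _ _ → cong (glue y≢x)) , glue-identifies y≢x , ℕ.≤-refl
  where
  y≢x = ≢-sym differ
  glued-surjective : StrictlySurjective _≡_ (glue y≢x ∘ label)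
  glued-surjective l with glue-surjective y≢x l
  ... | i , gi≡l with surjective i
  ...   | z , lz≡i = z , trans (cong (glue y≢x) lz≡i) gi≡l

indicator : Bool → ℕ
indicator b = if b then 1 else 0

mergeIf : ∀ {n} (p : Partition n) (x y : Fin n) (b : Bool) →
  Reachable (indicator b) (λ q → T b → Joins x y q) p
mergeIf p x y false = p , ⊑-refl p , (λ ()) , ℕ.≤-refl
mergeIf p x y true with merge p x y
... | q , p⊑q , joined , bound = q , p⊑q , (λ _ → joined) , bound

reachable-∑ : ∀ {n m} (E : Fin m → Partition n → Set) (cost : Fin m → ℕ) →
  (∀ i → UpwardClosed (E i)) → (∀ i p → Reachable (cost i) (E i) p) →
  ∀ p → Reachable (∑[ i < m ] cost i) (λ q → ∀ i → E i q) p
reachable-∑ {m = zero} E cost upward reach p = p , ⊑-refl p , (λ ()) , ℕ.≤-refl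
reachable-∑ {m = suc m} E cost upward reach p with reach zero p
... | q , p⊑q , Eq , bound
  with reachable-∑ (E ∘ suc) (cost ∘ suc) (upward ∘ suc) (reach ∘ suc) q
...   | r , q⊑r , Er , bound′ = r , (λ x y → q⊑r x y ∘ p⊑q x y) , E-all , bound″
  where
  E-all : ∀ i → E i r
  E-all zero    = upward zero q⊑r Eq
  E-all (suc i) = Er i
  bound″ : classes p ≤ (cost zero + ∑[ i < m ] cost (suc i)) + classes r
  bound″ = ℕ.≤-trans bound (ℕ.≤-trans (ℕ.+-monoʳ-≤ (cost zero) bound′)
             (ℕ.≤-reflexive (sym (ℕ.+-assoc (cost zero) _ (classes r)))))

count : ∀ {n} → (Fin n → Fin n → Bool) → ℕ
count {n} R = ∑[ i < n ] ∑[ j < n ] indicator (R i j)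

joinAll : ∀ {n} (R : Fin n → Fin n → Bool) (p : Partition n) →
  Reachable (count R) (λ q → ∀ i j → T (R i j) → Joins i j q) p
joinAll R = reachable-∑ (λ i q → ∀ j → T (R i j) → Joins i j q) _
  (λ i p⊑q joined j t → p⊑q _ _ (joined j t))
  (λ i → reachable-∑ (λ j q → T (R i j) → Joins i j q) _
           (λ j p⊑q joined t → p⊑q _ _ (joined t))
           (λ j p → mergeIf p i j (R i j)))

distinctLabels : ∀ {n} (p : Partition n) → 2 ≤ classes p →
  ∃[ u ] ∃[ v ] label p u ≢ label p v
distinctLabels (partition (suc (suc c)) label surjective) (s≤s (s≤s z≤n))
  with surjective zero | surjective (suc zero)
... | u , lu≡0 | v , lv≡1 = u , v , λ lu≡lv → 0≢1 (trans (sym lu≡0) (trans lu≡lv lv≡1))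
  where
  0≢1 : zero ≢ suc zero
  0≢1 ()

Before : ∀ {n} → Fin n → Fin n → Bool
Before i j = toℕ i <ᵇ toℕ j

nonEdgeCount : ∀ {n} → Graph n → ℕ
nonEdgeCount G = count (λ i j → Before i j ∧ not (adj G i j))

listSum-tabulate : ∀ {n} (f : Fin n → ℕ) → ListSum.sum (tabulate f) ≡ ∑[ i < n ] f i
listSum-tabulate {zero}  f = refl
listSum-tabulate {suc n} f = cong (f zero +_) (listSum-tabulate (f ∘ suc))

listSum-allFin : ∀ {n} (f : Fin n → ℕ) → ListSum.sum (map f (allFin n)) ≡ ∑[ i < n ] f i
listSum-allFin f = trans (cong ListSum.sum (map-tabulate id f)) (listSum-tabulate f)

edgeCount-count : ∀ {n} (G : Graph n) → edgeCount G ≡ count (λ i j → Before i j ∧ adj G i j)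
edgeCount-count {n} G =
  trans (listSum-allFin (λ i → ListSum.sum (map (edge i) (allFin n))))
        (sum-cong-≗ (λ i → listSum-allFin (edge i)))
  where
  edge : Fin n → Fin n → ℕ
  edge i j = indicator (Before i j ∧ adj G i j)

count-split : ∀ {n} (R S : Fin n → Fin n → Bool) →
  count (λ i j → R i j ∧ S i j) + count (λ i j → R i j ∧ not (S i j)) ≡ count R
count-split {n} R S =
  trans (sym (∑-distrib-+ (λ i → ∑[ j < n ] both i j) (λ i → ∑[ j < n ] only i j)))
    (sum-cong-≗ λ i → trans (sym (∑-distrib-+ (both i) (only i)))
      (sum-cong-≗ λ j → indicator-split (R i j) (S i j)))
  where
  both only : Fin n → Fin n → ℕ
  both i j = indicator (R i j ∧ S i j)
  only i j = indicator (R i j ∧ not (S i j))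
  indicator-split : ∀ r s → indicator (r ∧ s) + indicator (r ∧ not s) ≡ indicator r
  indicator-split false s     = refl
  indicator-split true  false = refl
  indicator-split true  true  = refl

∑-one : ∀ n → ∑[ i < n ] 1 ≡ n
∑-one zero    = refl
∑-one (suc n) = cong suc (∑-one n)

-- Row 0 of count Before has n ones and the other rows form count Before for n.
count-Before : ∀ n → 2 * count {n} Before + n ≡ n * n
count-Before zero    = refl
count-Before (suc n) = begin
  2 * count {suc n} Before + suc n         ≡⟨ cong (λ t → 2 * (t + c) + suc n) (∑-one n) ⟩
  2 * (n + c) + suc n                      ≡⟨ regroup n c ⟩
  (2 * c + n) + suc (2 * n)                ≡⟨ cong (_+ suc (2 * n)) (count-Before n) ⟩
  n * n + suc (2 * n)                      ≡⟨ square-suc n ⟩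
  suc n * suc n                            ∎
  where
  open ≡-Reasoning
  c = count {n} Before
  regroup : ∀ n c → 2 * (n + c) + suc n ≡ (2 * c + n) + suc (2 * n)
  regroup = solve-∀
  square-suc : ∀ n → n * n + suc (2 * n) ≡ suc n * suc n
  square-suc = solve-∀

nonEdgeCount≤ : ∀ {k} (G : Graph (suc (suc k))) → suc k * k < 2 * edgeCount G →
  nonEdgeCount G ≤ k
nonEdgeCount≤ {k} G dense with nonEdgeCount G ℕ.≤? k
... | yes f≤k = f≤k
... | no f≰k  = ⊥-elim (ℕ.<-irrefl refl (begin-strict
  n * n                           <⟨ ℕ.n<1+n _ ⟩
  suc (n * n)                     ≡⟨ expand k ⟩
  suc (suc k * k) + 2 * suc k + n ≤⟨ ℕ.+-monoˡ-≤ n (ℕ.+-mono-≤ dense (ℕ.*-monoʳ-≤ 2 k<f)) ⟩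
  2 * e + 2 * f + n               ≡⟨ cong (_+ n) (sym (ℕ.*-distribˡ-+ 2 e f)) ⟩
  2 * (e + f) + n                 ≡⟨ cong (λ t → 2 * t + n) e+f≡pairs ⟩
  2 * count {n} Before + n        ≡⟨ count-Before n ⟩
  n * n                           ∎))
  where
  open ℕ.≤-Reasoning
  n = suc (suc k)
  e = edgeCount G
  f = nonEdgeCount G
  k<f = ℕ.≰⇒> f≰k
  expand : ∀ k → suc (suc (suc k) * suc (suc k)) ≡ suc (suc k * k) + 2 * suc k + suc (suc k)
  expand = solve-∀
  e+f≡pairs : e + f ≡ count {n} Before
  e+f≡pairs = trans (cong (_+ f) (edgeCount-count G)) (count-split (Before {n}) (adj G))

module _ {n : ℕ} (G : Graph n) where

  Adj-sym : ∀ {x y} → Adj G x y → Adj G y x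
  Adj-sym {x} {y} x~y = trans (Graph.sym G y x) x~y

  Adj-irrefl : ∀ {x} → ¬ Adj G x x
  Adj-irrefl {x} x~x with trans (sym (Graph.irrefl G x)) x~x
  ... | ()

  nonAdj-sym : ∀ {x y} → ¬ Adj G x y → ¬ Adj G y x
  nonAdj-sym x≁y = x≁y ∘ Adj-sym

  adj? : ∀ x y → Dec (Adj G x y)
  adj? x y = adj G x y Bool.≟ true

  ComplementTriangle : Fin n → Fin n → Fin n → Set
  ComplementTriangle x y z =
    x ≢ y × y ≢ z × x ≢ z × ¬ Adj G x y × ¬ Adj G y z × ¬ Adj G x z

  ComplementSquare : Fin n → Fin n → Fin n → Fin n → Set
  ComplementSquare a b c d =
    a ≢ b × a ≢ c × a ≢ d × b ≢ c × b ≢ d × c ≢ d ×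
    ¬ Adj G a b × ¬ Adj G b c × ¬ Adj G c d × ¬ Adj G d a

  ComplementTriangleOrSquare : Set
  ComplementTriangleOrSquare =
    (∃[ x ] ∃[ y ] ∃[ z ] ComplementTriangle x y z) ⊎
    (∃[ a ] ∃[ b ] ∃[ c ] ∃[ d ] ComplementSquare a b c d)

  complementTriangle-rotate : ∀ {x y z} → ComplementTriangle x y z → ComplementTriangle y z x
  complementTriangle-rotate (x≢y , y≢z , x≢z , x≁y , y≁z , x≁z) =
    y≢z , ≢-sym x≢z , ≢-sym x≢y , y≁z , nonAdj-sym x≁z , nonAdj-sym x≁y

  complementTriangle-swap : ∀ {x y z} → ComplementTriangle x y z → ComplementTriangle x z y
  complementTriangle-swap (x≢y , y≢z , x≢z , x≁y , y≁z , x≁z) =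
    x≢z , ≢-sym y≢z , x≢y , x≁z , nonAdj-sym y≁z , x≁y

  complementSquare-rotate : ∀ {a b c d} → ComplementSquare a b c d → ComplementSquare b c d a
  complementSquare-rotate (a≢b , a≢c , a≢d , b≢c , b≢d , c≢d , a≁b , b≁c , c≁d , d≁a) =
    b≢c , b≢d , ≢-sym a≢b , c≢d , ≢-sym a≢c , ≢-sym a≢d , b≁c , c≁d , d≁a , a≁b

  pair-nonAdj : ∀ {a b x y} → ¬ Adj G a b →
    x ∈ a ∷ b ∷ [] → y ∈ a ∷ b ∷ [] → x ≢ y → ¬ Adj G x y
  pair-nonAdj a≁b (here refl)         (here refl)         x≢y = ⊥-elim (x≢y refl)
  pair-nonAdj a≁b (here refl)         (there (here refl)) x≢y = a≁b
  pair-nonAdj a≁b (there (here refl)) (here refl)         x≢y = nonAdj-sym a≁b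
  pair-nonAdj a≁b (there (here refl)) (there (here refl)) x≢y = ⊥-elim (x≢y refl)

  pair-adjacent : ∀ {a b x y q} → x ∈ a ∷ b ∷ [] → y ∈ a ∷ b ∷ [] → x ≢ y →
    Adj G q x → Adj G q y → Adj G q a × Adj G q b
  pair-adjacent (here refl)         (here refl)         x≢y _   _   = ⊥-elim (x≢y refl)
  pair-adjacent (here refl)         (there (here refl)) x≢y q~a q~b = q~a , q~b
  pair-adjacent (there (here refl)) (here refl)         x≢y q~b q~a = q~a , q~b
  pair-adjacent (there (here refl)) (there (here refl)) x≢y _   _   = ⊥-elim (x≢y refl)

  -- The middle vertex of a two-coloured P4 is adjacent to two distinct vertices of one colour.
  starColouring-intro : ∀ {k} {col : Fin n → Fin k} →
    (∀ {x y} → col x ≡ col y → x ≢ y → ¬ Adj G x y) →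
    (∀ {p q r s} → col p ≡ col r → p ≢ r → col q ≡ col s → q ≢ s →
      Adj G q p → Adj G q r → ⊥) →
    StarColouring G k col
  starColouring-intro {col = col} independent noFork = proper , noTwoColouredP4
    where
    proper : Proper G col
    proper x y x~y cx≡cy = independent cx≡cy (λ { refl → Adj-irrefl x~y }) x~y
    noTwoColouredP4 : ¬ TwoColouredP4 G col
    noTwoColouredP4 (p , q , r , s , (_ , p≢r , _ , _ , q≢s , _ , p~q , q~r , _) , cp≡cr , cq≡cs) =
      noFork cp≡cr p≢r cq≡cs q≢s (Adj-sym p~q) q~r

starColourable-of-complementTriangle : ∀ {k} (G : Graph (suc (suc k))) {a b c} →
  ComplementTriangle G a b c → StarColourable G k
starColourable-of-complementTriangle G {a} {b} {c} (a≢b , b≢c , a≢c , a≁b , b≁c , a≁c) =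
  col , starColouring-intro G
    (λ cx≡cy x≢y →
      independent (proj₁ (collision cx≡cy x≢y)) (proj₂ (collision cx≡cy x≢y)))
    (λ cp≡cr p≢r cq≡cs q≢s q~p _ →
      independent (proj₁ (collision cq≡cs q≢s)) (proj₁ (collision cp≡cr p≢r)) q~p)
  where
  ABC = a ∷ b ∷ c ∷ []
  b≢a = ≢-sym a≢b
  c∉ab = ∉-pair a≢c b≢c
  gc≢ga : glue b≢a c ≢ glue b≢a a
  gc≢ga gc≡ga = a≢c (glue-cancel b≢a c∉ab (sym gc≡ga))
  col = glue gc≢ga ∘ glue b≢a
  widen : ∀ {x} → x ∈ a ∷ b ∷ [] → x ∈ ABC
  widen (here x≡a)         = here x≡a
  widen (there (here x≡b)) = there (here x≡b)
  preimage : ∀ {x} → glue b≢a x ∈ glue b≢a a ∷ glue b≢a c ∷ [] → x ∈ ABC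
  preimage {x} (here gx≡ga) with glue-collision b≢a x a gx≡ga
  ... | inj₁ x≡a        = here x≡a
  ... | inj₂ (x∈ab , _) = widen x∈ab
  preimage (there (here gx≡gc)) = there (there (here (glue-cancel b≢a c∉ab gx≡gc)))
  collision : ∀ {x y} → col x ≡ col y → x ≢ y → x ∈ ABC × y ∈ ABC
  collision {x} {y} cx≡cy x≢y with glue-collision gc≢ga (glue b≢a x) (glue b≢a y) cx≡cy
  ... | inj₂ (gx∈ , gy∈) = preimage gx∈ , preimage gy∈
  ... | inj₁ gx≡gy with glue-collision b≢a x y gx≡gy
  ...   | inj₁ x≡y           = ⊥-elim (x≢y x≡y)
  ...   | inj₂ (x∈ab , y∈ab) = widen x∈ab , widen y∈ab
  independent : ∀ {x y} → x ∈ ABC → y ∈ ABC → ¬ Adj G x y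
  independent (here refl)                 (here refl)                 = Adj-irrefl G
  independent (here refl)                 (there (here refl))         = a≁b
  independent (here refl)                 (there (there (here refl))) = a≁c
  independent (there (here refl))         (here refl)                 = nonAdj-sym G a≁b
  independent (there (here refl))         (there (here refl))         = Adj-irrefl G
  independent (there (here refl))         (there (there (here refl))) = b≁c
  independent (there (there (here refl))) (here refl)                 = nonAdj-sym G a≁c
  independent (there (there (here refl))) (there (here refl))         = nonAdj-sym G b≁c
  independent (there (there (here refl))) (there (there (here refl))) = Adj-irrefl G

starColourable-of-complementSquare : ∀ {k} (G : Graph (suc (suc k))) {a b c d} →
  ComplementSquare G a b c d → StarColourable G k
starColourable-of-complementSquare G {a} {b} {c} {d}
  (a≢b , a≢c , a≢d , b≢c , b≢d , c≢d , a≁b , b≁c , c≁d , d≁a) =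
  col , starColouring-intro G independent noFork
  where
  AB = a ∷ b ∷ []
  CD = c ∷ d ∷ []
  b≢a = ≢-sym a≢b
  c∉ab = ∉-pair a≢c b≢c
  d∉ab = ∉-pair a≢d b≢d
  gd≢gc : glue b≢a d ≢ glue b≢a c
  gd≢gc gd≡gc = c≢d (sym (glue-cancel b≢a c∉ab gd≡gc))
  col = glue gd≢gc ∘ glue b≢a
  preimage : ∀ {x} → glue b≢a x ∈ glue b≢a c ∷ glue b≢a d ∷ [] → x ∈ CD
  preimage (here gx≡gc)         = here (glue-cancel b≢a c∉ab gx≡gc)
  preimage (there (here gx≡gd)) = there (here (glue-cancel b≢a d∉ab gx≡gd))
  collision : ∀ {x y} → col x ≡ col y → x ≢ y → (x ∈ AB × y ∈ AB) ⊎ (x ∈ CD × y ∈ CD)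
  collision {x} {y} cx≡cy x≢y with glue-collision gd≢gc (glue b≢a x) (glue b≢a y) cx≡cy
  ... | inj₂ (gx∈ , gy∈) = inj₂ (preimage gx∈ , preimage gy∈)
  ... | inj₁ gx≡gy with glue-collision b≢a x y gx≡gy
  ...   | inj₁ x≡y     = ⊥-elim (x≢y x≡y)
  ...   | inj₂ x,y∈ab = inj₁ x,y∈ab
  independent : ∀ {x y} → col x ≡ col y → x ≢ y → ¬ Adj G x y
  independent cx≡cy x≢y with collision cx≡cy x≢y
  ... | inj₁ (x∈ , y∈) = pair-nonAdj G a≁b x∈ y∈ x≢y
  ... | inj₂ (x∈ , y∈) = pair-nonAdj G c≁d x∈ y∈ x≢y
  -- Each of a, b, c, d is non-adjacent to a vertex of the other pair.
  fork-ab : ∀ {q} → q ∈ AB ⊎ q ∈ CD → Adj G q a → Adj G q b → ⊥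
  fork-ab (inj₁ (here refl))         a~a _   = Adj-irrefl G a~a
  fork-ab (inj₁ (there (here refl))) _   b~b = Adj-irrefl G b~b
  fork-ab (inj₂ (here refl))         _   c~b = b≁c (Adj-sym G c~b)
  fork-ab (inj₂ (there (here refl))) d~a _   = d≁a d~a
  fork-cd : ∀ {q} → q ∈ AB ⊎ q ∈ CD → Adj G q c → Adj G q d → ⊥
  fork-cd (inj₁ (here refl))         _   a~d = d≁a (Adj-sym G a~d)
  fork-cd (inj₁ (there (here refl))) b~c _   = b≁c b~c
  fork-cd (inj₂ (here refl))         c~c _   = Adj-irrefl G c~c
  fork-cd (inj₂ (there (here refl))) _   d~d = Adj-irrefl G d~d
  noFork : ∀ {p q r s} → col p ≡ col r → p ≢ r → col q ≡ col s → q ≢ s →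
    Adj G q p → Adj G q r → ⊥
  noFork cp≡cr p≢r cq≡cs q≢s q~p q~r
    with Sum.map proj₁ proj₁ (collision cq≡cs q≢s) | collision cp≡cr p≢r
  ... | q∈ | inj₁ (p∈ , r∈) =
    let q~a , q~b = pair-adjacent G p∈ r∈ p≢r q~p q~r in fork-ab q∈ q~a q~b
  ... | q∈ | inj₂ (p∈ , r∈) =
    let q~c , q~d = pair-adjacent G p∈ r∈ p≢r q~p q~r in fork-cd q∈ q~c q~d

starColourable-of-complementTriangleOrSquare : ∀ {k} (G : Graph (suc (suc k))) →
  ComplementTriangleOrSquare G → StarColourable G k
starColourable-of-complementTriangleOrSquare G (inj₁ (_ , _ , _ , triangle)) =
  starColourable-of-complementTriangle G triangle
starColourable-of-complementTriangleOrSquare G (inj₂ (_ , _ , _ , _ , square)) =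
  starColourable-of-complementSquare G square

MonochromaticTriple : ∀ {n k} → (Fin n → Fin k) → Set
MonochromaticTriple {n} col =
  ∃[ x ] ∃[ y ] ∃[ z ] (x ≢ y × y ≢ z × x ≢ z × col x ≡ col y × col y ≡ col z)

TwoMonochromaticPairs : ∀ {n k} → (Fin n → Fin k) → Set
TwoMonochromaticPairs {n} col =
  ∃[ a ] ∃[ b ] ∃[ c ] ∃[ d ]
    (a ≢ b × c ≢ d × col a ≡ col b × col c ≡ col d × col a ≢ col c)

-- Pigeonhole once for a monochromatic pair a, b, and once more after removing b.
pigeonhole₂ : ∀ {N j} → j < N → (col : Fin (suc N) → Fin j) →
  MonochromaticTriple col ⊎ TwoMonochromaticPairs col
pigeonhole₂ j<N col with Finₚ.pigeonhole (ℕ.m<n⇒m<1+n j<N) col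
... | a , b , a<b , ca≡cb with Finₚ.pigeonhole j<N (col ∘ punchIn b)
... | c , d , c<d , cc≡cd with col (punchIn b c) Fin.≟ col a | punchIn b c Fin.≟ a
... | yes cc≡ca | yes refl =
  inj₁ (a , b , punchIn b d , Finₚ.<⇒≢ a<b , ≢-sym (Finₚ.punchInᵢ≢i b d) ,
        Finₚ.<⇒≢ c<d ∘ Finₚ.punchIn-injective b c d , ca≡cb , trans (sym ca≡cb) cc≡cd)
... | yes cc≡ca | no c↑≢a =
  inj₁ (a , b , punchIn b c , Finₚ.<⇒≢ a<b , ≢-sym (Finₚ.punchInᵢ≢i b c) , ≢-sym c↑≢a ,
        ca≡cb , trans (sym ca≡cb) (sym cc≡ca))
... | no cc≢ca | _ =
  inj₂ (a , b , punchIn b c , punchIn b d , Finₚ.<⇒≢ a<b ,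
        Finₚ.<⇒≢ c<d ∘ Finₚ.punchIn-injective b c d , ca≡cb , cc≡cd , ≢-sym cc≢ca)

module _ {n k : ℕ} (G : Graph n) {col : Fin n → Fin k} where

  complementTriangle-of-monochromaticTriple : Proper G col → MonochromaticTriple col →
    ∃[ x ] ∃[ y ] ∃[ z ] ComplementTriangle G x y z
  complementTriangle-of-monochromaticTriple proper
    (x , y , z , x≢y , y≢z , x≢z , cx≡cy , cy≡cz) =
    x , y , z , x≢y , y≢z , x≢z ,
    (λ x~y → proper x y x~y cx≡cy) , (λ y~z → proper y z y~z cy≡cz) ,
    (λ x~z → proper x z x~z (trans cx≡cy cy≡cz))

  -- a, c, b, d alternates between the two colours, so three consecutive edges of the cycle
  -- a c b d a would form a two-coloured P4.
  complementTriangleOrSquare-of-twoMonochromaticPairs : StarColouring G k col →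
    TwoMonochromaticPairs col → ComplementTriangleOrSquare G
  complementTriangleOrSquare-of-twoMonochromaticPairs (proper , noP4)
    (a , b , c , d , a≢b , c≢d , ca≡cb , cc≡cd , ca≢cc) =
    cases (adj? G a c) (adj? G c b) (adj? G b d) (adj? G d a)
    where
    a≢c : a ≢ c
    a≢c refl = ca≢cc refl
    a≢d : a ≢ d
    a≢d refl = ca≢cc (sym cc≡cd)
    b≢c : b ≢ c
    b≢c refl = ca≢cc ca≡cb
    b≢d : b ≢ d
    b≢d refl = ca≢cc (trans ca≡cb (sym cc≡cd))
    a≁b : ¬ Adj G a b
    a≁b a~b = proper a b a~b ca≡cb
    c≁d : ¬ Adj G c d
    c≁d c~d = proper c d c~d cc≡cd
    cases : Dec (Adj G a c) → Dec (Adj G c b) → Dec (Adj G b d) → Dec (Adj G d a) →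
      ComplementTriangleOrSquare G
    cases (no a≁c) (no c≁b) _ _ =
      inj₁ (a , c , b , a≢c , ≢-sym b≢c , a≢b , a≁c , c≁b , a≁b)
    cases (no a≁c) (yes _) _ (no d≁a) =
      inj₁ (a , c , d , a≢c , c≢d , a≢d , a≁c , c≁d , nonAdj-sym G d≁a)
    cases (yes _) (no c≁b) (no b≁d) _ =
      inj₁ (c , b , d , ≢-sym b≢c , b≢d , c≢d , c≁b , b≁d , c≁d)
    cases (yes _) (yes _) (no b≁d) (no d≁a) =
      inj₁ (b , d , a , b≢d , ≢-sym a≢d , ≢-sym a≢b , b≁d , d≁a , nonAdj-sym G a≁b)
    cases (yes _) (no c≁b) (yes _) (no d≁a) =
      inj₂ (a , b , c , d , a≢b , a≢c , a≢d , b≢c , b≢d , c≢d ,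
            a≁b , nonAdj-sym G c≁b , c≁d , d≁a)
    cases (no a≁c) (yes _) (no b≁d) (yes _) =
      inj₂ (a , b , d , c , a≢b , a≢d , a≢c , b≢d , b≢c , ≢-sym c≢d ,
            a≁b , b≁d , nonAdj-sym G c≁d , nonAdj-sym G a≁c)
    cases (yes a~c) (yes c~b) (yes b~d) _ = ⊥-elim (noP4
      (a , c , b , d , (a≢c , a≢b , a≢d , ≢-sym b≢c , c≢d , b≢d , a~c , c~b , b~d) ,
       ca≡cb , cc≡cd))
    cases (yes a~c) (yes c~b) (no _) (yes d~a) = ⊥-elim (noP4
      (d , a , c , b ,
       (≢-sym a≢d , ≢-sym c≢d , ≢-sym b≢d , a≢c , a≢b , ≢-sym b≢c , d~a , a~c , c~b) ,
       sym cc≡cd , ca≡cb))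
    cases (yes a~c) (no _) (yes b~d) (yes d~a) = ⊥-elim (noP4
      (b , d , a , c ,
       (b≢d , ≢-sym a≢b , b≢c , ≢-sym a≢d , ≢-sym c≢d , a≢c , b~d , d~a , a~c) ,
       sym ca≡cb , sym cc≡cd))
    cases (no _) (yes c~b) (yes b~d) (yes d~a) = ⊥-elim (noP4
      (c , b , d , a ,
       (≢-sym b≢c , c≢d , ≢-sym a≢c , b≢d , ≢-sym a≢b , ≢-sym a≢d , c~b , b~d , d~a) ,
       cc≡cd , sym ca≡cb))

complementTriangleOrSquare-of-starColouring : ∀ {N j} (G : Graph (suc N))
  {col : Fin (suc N) → Fin j} → StarColouring G j col → j < N → ComplementTriangleOrSquare G
complementTriangleOrSquare-of-starColouring G {col} star@(proper , _) j<N
  with pigeonhole₂ j<N col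
... | inj₁ triple = inj₁ (complementTriangle-of-monochromaticTriple G proper triple)
... | inj₂ pairs  = complementTriangleOrSquare-of-twoMonochromaticPairs G star pairs

Endpoints : ∀ {n} → Fin n → Fin n → Fin n → Fin n → Set
Endpoints u v x y = (x ≡ u × y ≡ v) ⊎ (x ≡ v × y ≡ u)

endpoints-unique : ∀ {n} {u v x y x′ y′ : Fin n} →
  Endpoints u v x y → Endpoints u v x′ y′ → (x ≡ x′ × y ≡ y′) ⊎ (x ≡ y′ × y ≡ x′)
endpoints-unique (inj₁ (refl , refl)) (inj₁ (refl , refl)) = inj₁ (refl , refl)
endpoints-unique (inj₁ (refl , refl)) (inj₂ (refl , refl)) = inj₂ (refl , refl)
endpoints-unique (inj₂ (refl , refl)) (inj₁ (refl , refl)) = inj₂ (refl , refl)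
endpoints-unique (inj₂ (refl , refl)) (inj₂ (refl , refl)) = inj₁ (refl , refl)

∧-not-∨-≢true : ∀ a p q r s → a ∧ not ((p ∧ q) ∨ (r ∧ s)) ≢ true →
  a ≢ true ⊎ (T p × T q) ⊎ (T r × T s)
∧-not-∨-≢true false _     _     _     _     _ = inj₁ (λ ())
∧-not-∨-≢true true  true  true  _     _     _ = inj₂ (inj₁ (_ , _))
∧-not-∨-≢true true  _     _     true  true  _ = inj₂ (inj₂ (_ , _))
∧-not-∨-≢true true  true  false true  false h = ⊥-elim (h refl)
∧-not-∨-≢true true  true  false false _     h = ⊥-elim (h refl)
∧-not-∨-≢true true  false _     true  false h = ⊥-elim (h refl)
∧-not-∨-≢true true  false _     false _     h = ⊥-elim (h refl)

nonAdj-deleteEdge : ∀ {n} (G : Graph n) {u v x y} →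
  ¬ Adj (deleteEdge G u v) x y → ¬ Adj G x y ⊎ Endpoints u v x y
nonAdj-deleteEdge G {u} {v} {x} {y} x≁y
  with ∧-not-∨-≢true (adj G x y) ⌊ x Fin.≟ u ⌋ ⌊ y Fin.≟ v ⌋ ⌊ x Fin.≟ v ⌋ ⌊ y Fin.≟ u ⌋ x≁y
... | inj₁ x≁y′               = inj₁ x≁y′
... | inj₂ (inj₁ (x≡u , y≡v)) = inj₂ (inj₁ (toWitness x≡u , toWitness y≡v))
... | inj₂ (inj₂ (x≡v , y≡u)) = inj₂ (inj₂ (toWitness x≡v , toWitness y≡u))

record SeparatedInComplement {n} (G : Graph n) (u v : Fin n) : Set where
  field
    sides       : ℕ
    side        : Fin n → Fin sides
    side-nonAdj : ∀ {x y} → ¬ Adj G x y → side x ≡ side y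
    separates   : side u ≢ side v

module _ {n : ℕ} (G : Graph n) {u v : Fin n} (separated : SeparatedInComplement G u v) where
  open SeparatedInComplement separated

  separated⇒adjacent : Adj G u v
  separated⇒adjacent with adj? G u v
  ... | yes u~v = u~v
  ... | no u≁v  = ⊥-elim (separates (side-nonAdj u≁v))

  private
    G-uv = deleteEdge G u v

    nonAdj-lift : ∀ {x y} → ¬ Adj G-uv x y → ¬ Endpoints u v x y → ¬ Adj G x y
    nonAdj-lift x≁y ¬uv with nonAdj-deleteEdge G x≁y
    ... | inj₁ x≁y′ = x≁y′
    ... | inj₂ uv   = ⊥-elim (¬uv uv)

    same-side : ∀ {x y} → ¬ Adj G-uv x y → ¬ Endpoints u v x y → side x ≡ side y
    same-side x≁y ¬uv = side-nonAdj (nonAdj-lift x≁y ¬uv)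

    endpoints-split : ∀ {x y} → Endpoints u v x y → side x ≢ side y
    endpoints-split (inj₁ (refl , refl)) = separates
    endpoints-split (inj₂ (refl , refl)) = separates ∘ sym

  -- The rest of a complement cycle through uv would join u to v in the complement of G.
  complementTriangle-avoids-uv : ∀ {x y z} → ComplementTriangle G-uv x y z →
    ¬ Endpoints u v x y
  complementTriangle-avoids-uv {x} {y} {z} (x≢y , y≢z , x≢z , _ , y≁z , x≁z) xy =
    endpoints-split xy (trans (same-side x≁z ¬xz) (sym (same-side y≁z ¬yz)))
    where
    ¬xz : ¬ Endpoints u v x z
    ¬xz xz with endpoints-unique xy xz
    ... | inj₁ (_ , y≡z) = y≢z y≡z
    ... | inj₂ (x≡z , _) = x≢z x≡z
    ¬yz : ¬ Endpoints u v y z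
    ¬yz yz with endpoints-unique xy yz
    ... | inj₁ (x≡y , _) = x≢y x≡y
    ... | inj₂ (x≡z , _) = x≢z x≡z

  complementSquare-avoids-uv : ∀ {a b c d} → ComplementSquare G-uv a b c d →
    ¬ Endpoints u v a b
  complementSquare-avoids-uv {a} {b} {c} {d}
    (a≢b , a≢c , a≢d , b≢c , b≢d , c≢d , _ , b≁c , c≁d , d≁a) ab =
    endpoints-split ab
      (sym (trans (same-side b≁c ¬bc) (trans (same-side c≁d ¬cd) (same-side d≁a ¬da))))
    where
    ¬bc : ¬ Endpoints u v b c
    ¬bc bc with endpoints-unique ab bc
    ... | inj₁ (a≡b , _) = a≢b a≡b
    ... | inj₂ (a≡c , _) = a≢c a≡c
    ¬cd : ¬ Endpoints u v c d
    ¬cd cd with endpoints-unique ab cd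
    ... | inj₁ (a≡c , _) = a≢c a≡c
    ... | inj₂ (a≡d , _) = a≢d a≡d
    ¬da : ¬ Endpoints u v d a
    ¬da da with endpoints-unique ab da
    ... | inj₁ (a≡d , _) = a≢d a≡d
    ... | inj₂ (_ , b≡d) = b≢d b≡d

  complementTriangle-lift : ∀ {x y z} → ComplementTriangle G-uv x y z →
    ComplementTriangle G x y z
  complementTriangle-lift t@(x≢y , y≢z , x≢z , x≁y , y≁z , x≁z) =
    x≢y , y≢z , x≢z ,
    nonAdj-lift x≁y (complementTriangle-avoids-uv t) ,
    nonAdj-lift y≁z (complementTriangle-avoids-uv (complementTriangle-rotate G-uv t)) ,
    nonAdj-lift x≁z (complementTriangle-avoids-uv (complementTriangle-swap G-uv t))

  complementSquare-lift : ∀ {a b c d} → ComplementSquare G-uv a b c d →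
    ComplementSquare G a b c d
  complementSquare-lift s@(a≢b , a≢c , a≢d , b≢c , b≢d , c≢d , a≁b , b≁c , c≁d , d≁a) =
    a≢b , a≢c , a≢d , b≢c , b≢d , c≢d ,
    nonAdj-lift a≁b (complementSquare-avoids-uv s) ,
    nonAdj-lift b≁c (complementSquare-avoids-uv s₁) ,
    nonAdj-lift c≁d (complementSquare-avoids-uv s₂) ,
    nonAdj-lift d≁a (complementSquare-avoids-uv (complementSquare-rotate G-uv s₂))
    where
    s₁ = complementSquare-rotate G-uv s
    s₂ = complementSquare-rotate G-uv s₁

  complementTriangleOrSquare-lift : ComplementTriangleOrSquare G-uv →
    ComplementTriangleOrSquare G
  complementTriangleOrSquare-lift (inj₁ (x , y , z , t)) =
    inj₁ (x , y , z , complementTriangle-lift t)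
  complementTriangleOrSquare-lift (inj₂ (a , b , c , d , s)) =
    inj₂ (a , b , c , d , complementSquare-lift s)

T-∧-not : ∀ {b c} → T b → c ≢ true → T (b ∧ not c)
T-∧-not {true} {false} _ _      = tt
T-∧-not {true} {true}  _ c≢true = c≢true refl

-- Starting from n singleton classes, merging along each of the at most n − 2 non-edges
-- leaves at least two classes.
separatedInComplement : ∀ {k} (G : Graph (suc (suc k))) → nonEdgeCount G ≤ k →
  ∃[ u ] ∃[ v ] SeparatedInComplement G u v
separatedInComplement {k} G f≤k with joinAll (λ i j → Before i j ∧ not (adj G i j)) discrete
... | q , _ , joined , n≤f+c with distinctLabels q two-classes
  where
  open ℕ.≤-Reasoning
  two-classes : 2 ≤ classes q
  two-classes = ℕ.+-cancelˡ-≤ k 2 (classes q) (begin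
    k + 2                      ≡⟨ ℕ.+-comm k 2 ⟩
    suc (suc k)                ≤⟨ n≤f+c ⟩
    nonEdgeCount G + classes q ≤⟨ ℕ.+-monoˡ-≤ (classes q) f≤k ⟩
    k + classes q              ∎)
...   | u , v , lu≢lv = u , v , record
  { sides = classes q ; side = label q ; side-nonAdj = nonAdj-joined ; separates = lu≢lv }
  where
  nonAdj-joined : ∀ {x y} → ¬ Adj G x y → label q x ≡ label q y
  nonAdj-joined {x} {y} x≁y with Finₚ.<-cmp x y
  ... | tri< x<y _ _  = joined x y (T-∧-not (ℕ.<⇒<ᵇ x<y) x≁y)
  ... | tri≈ _ refl _ = refl
  ... | tri> _ _ y<x  = sym (joined y x (T-∧-not (ℕ.<⇒<ᵇ y<x) (nonAdj-sym G x≁y)))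

mainTheorem12 : (n : ℕ) → 5 ≤ n → (G : Graph n) → Connected G →
    StarChromatic G (n ∸ 1) →
    (n ∸ 1) * (n ∸ 2) < 2 * edgeCount G →
    ¬ Critical G (n ∸ 1)
mainTheorem12 (suc (suc k)) _ G _ (_ , optimal) dense (_ , critical)
  with u , v , separated ← separatedInComplement G (nonEdgeCount≤ G dense)
  with j , j<k+1 , ((_ , star) , _) ← critical u v (separated⇒adjacent G separated) =
  optimal k (ℕ.n<1+n k) (starColourable-of-complementTriangleOrSquare G
    (complementTriangleOrSquare-lift G separated
      (complementTriangleOrSquare-of-starColouring (deleteEdge G u v) star j<k+1)))
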